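{- Let $q\ge 1$ be an integer and let $G$ be a finite graph with at least one edge and average degree $d_G=2|E(G)|/|V(G)|$. Then for every edge $q$-coloring of $G$ there is a color $c$ whose color subgraph $G^c$ has average degree $2|E(G^c)|/|V(G^c)|\ge d_G/q$.
   Context: An edge $q$-coloring of a graph is an assignment of colors to its edges such that each vertex is incident to edges of at most $q$ distinct colors. For a color $c$, the color subgraph $G^c$ is the edge-induced subgraph of $G$ consisting of all edges of color $c$ and the vertices incident to them. -}

module Defs where

open import Data.Nat using (ℕ; zero; suc; _+_; _*_; _≤_; _<_)
open import Data.Fin using (Fin)
open import Data.Fin.Properties using () renaming (_≟_ to _≟ᶠ_)
open import Data.List using (List; length; filter; map)
open import Data.List.Relation.Unary.Any using (Any)
open import Data.List.Relation.Unary.All using (All)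
open import Data.List.Relation.Unary.AllPairs using (AllPairs)
open import Data.List.Relation.Unary.Unique.Propositional using (Unique)
open import Data.List.Membership.Propositional using (_∈_)
open import Data.List.Relation.Unary.Any using (any?)
open import Data.Vec.Functional using (Vector)
open import Data.Product using (Σ; _×_; _,_; proj₁; proj₂)
open import Data.Sum using (_⊎_)
open import Relation.Binary.PropositionalEquality using (_≡_)
open import Relation.Nullary using (¬_; Dec)
open import Relation.Nullary.Decidable using (_⊎-dec_; _×-dec_)
open import Data.Nat.Properties using () renaming (_≟_ to _≟ℕ_)

-- A finite (simple, undirected) graph on vertex set Fin n, given by
-- a list of m edges (each edge an unordered pair stored as an ordered pair).
record Graph : Set where
  field
    n     : ℕ
    m     : ℕ
    edge  : Fin m → Fin n × Fin n
    loopless : ∀ e → ¬ (proj₁ (edge e) ≡ proj₂ (edge e))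
    simple : ∀ e f → (proj₁ (edge e) ≡ proj₁ (edge f) × proj₂ (edge e) ≡ proj₂ (edge f))
                   ⊎ (proj₁ (edge e) ≡ proj₂ (edge f) × proj₂ (edge e) ≡ proj₁ (edge f))
                   → e ≡ f
open Graph public

Incident : (G : Graph) → Fin (m G) → Fin (n G) → Set
Incident G e v = (proj₁ (edge G e) ≡ v) ⊎ (proj₂ (edge G e) ≡ v)

incident? : (G : Graph) → ∀ e v → Dec (Incident G e v)
incident? G e v = (proj₁ (edge G e) ≟ᶠ v) ⊎-dec (proj₂ (edge G e) ≟ᶠ v)

Colouring : Graph → Set
Colouring G = Fin (m G) → ℕ

-- Edge q-colouring: each vertex v sees at most q distinct colours, i.e.
-- every duplicate-free list of colours each appearing on some edge at v
-- has length ≤ q.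
IsEdgeQColouring : (G : Graph) → ℕ → Colouring G → Set
IsEdgeQColouring G q col =
  ∀ (v : Fin (n G)) (cs : List ℕ) → Unique cs →
    All (λ c → Σ (Fin (m G)) λ e → Incident G e v × col e ≡ c) cs →
    length cs ≤ q

count : ∀ {k} {P : Fin k → Set} → (∀ i → Dec (P i)) → ℕ
count {k} P? = length (filter P? (Data.List.tabulate {n = k} (λ i → i)))
  where import Data.List

edgesOfColour : (G : Graph) → Colouring G → ℕ → ℕ
edgesOfColour G col c = count (λ e → col e ≟ℕ c)

verticesOfColour : (G : Graph) → Colouring G → ℕ → ℕ
verticesOfColour G col c =
  count {n G} (λ v → Data.Fin.Properties.any? (λ e → (col e ≟ℕ c) ×-dec incident? G e v))
  where import Data.Fin.Properties

-- Let cs be the colours in use. Every edge lies in exactly one colour subgraph, so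
-- Σ_{c ∈ cs} |E(G^c)| = |E(G)|, and every vertex lies in at most q colour subgraphs, so
-- Σ_{c ∈ cs} |V(G^c)| ≤ q |V(G)|. Hence the mediant of the ratios 2|E(G^c)| / |V(G^c)|
-- is at least d_G / q, and so is the largest of them.
module Submission where

open import Defs
open import Data.Nat using (ℕ; _+_; _*_; _≤_; _<_; _≥_; z≤n)
open import Data.Nat.Properties
open import Data.Fin using (Fin; fromℕ<)
open import Data.Fin.Properties using (toℕ<n; any?)
open import Data.Bool using (true; false; if_then_else_)
open import Data.Product using (Σ; _×_; _,_; proj₁)
open import Data.List using (List; []; _∷_; length; filter; map; tabulate; deduplicate; allFin)
open import Data.Nat.ListAction using (sum)
open import Data.List.Properties using (map-cong; length-tabulate)
import Data.List.Relation.Unary.All as All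
open import Data.List.Relation.Unary.All.Properties using (all-filter)
open import Data.List.Relation.Unary.Any using (Any; here; there)
open import Data.List.Relation.Unary.Unique.Propositional using (Unique)
open import Data.List.Relation.Unary.Unique.Propositional.Properties using () renaming (filter⁺ to Unique-filter⁺)
open import Data.List.Relation.Unary.Unique.DecPropositional.Properties using (deduplicate-!)
open import Data.List.Membership.Propositional using (_∈_; find)
open import Data.List.Membership.Propositional.Properties
  using (∈-length; ∈-filter⁺; ∈-map⁺; ∈-map⁻; ∈-allFin; ∈-deduplicate⁺; ∈-deduplicate⁻)
open import Algebra.Properties.CommutativeSemigroup +-commutativeSemigroup using (interchange)
open import Relation.Nullary using (Dec; does; yes; no)
open import Relation.Nullary.Decidable using (_×-dec_)
open import Relation.Unary using (Pred; Decidable)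
open import Relation.Binary.PropositionalEquality using (_≡_; refl; sym; trans; cong; cong₂; module ≡-Reasoning)

indicator : ∀ {p} {P : Set p} → Dec P → ℕ
indicator P? = if does P? then 1 else 0

module _ {a} {A : Set a} where

  sum-map-+ : (f g : A → ℕ) (xs : List A) →
              sum (map (λ x → f x + g x) xs) ≡ sum (map f xs) + sum (map g xs)
  sum-map-+ f g []       = refl
  sum-map-+ f g (x ∷ xs) = begin
    f x + g x + sum (map (λ x → f x + g x) xs)     ≡⟨ cong (f x + g x +_) (sum-map-+ f g xs) ⟩
    f x + g x + (sum (map f xs) + sum (map g xs))  ≡⟨ interchange (f x) (g x) _ _ ⟩
    f x + sum (map f xs) + (g x + sum (map g xs))  ∎
    where open ≡-Reasoning

  sum-map-*ˡ : (k : ℕ) (f : A → ℕ) (xs : List A) →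
               sum (map (λ x → k * f x) xs) ≡ k * sum (map f xs)
  sum-map-*ˡ k f []       = sym (*-zeroʳ k)
  sum-map-*ˡ k f (x ∷ xs) =
    trans (cong (k * f x +_) (sum-map-*ˡ k f xs)) (sym (*-distribˡ-+ k (f x) _))

  sum-map-*ʳ : (k : ℕ) (f : A → ℕ) (xs : List A) →
               sum (map (λ x → f x * k) xs) ≡ sum (map f xs) * k
  sum-map-*ʳ k f []       = refl
  sum-map-*ʳ k f (x ∷ xs) =
    trans (cong (f x * k +_) (sum-map-*ʳ k f xs)) (sym (*-distribʳ-+ k (f x) _))

  sum-map-const : (k : ℕ) (xs : List A) → sum (map (λ _ → k) xs) ≡ length xs * k
  sum-map-const k []       = refl
  sum-map-const k (x ∷ xs) = cong (k +_) (sum-map-const k xs)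

  sum-map-mono-≤ : {f g : A → ℕ} → (∀ x → f x ≤ g x) → (xs : List A) →
                   sum (map f xs) ≤ sum (map g xs)
  sum-map-mono-≤ f≤g []       = z≤n
  sum-map-mono-≤ f≤g (x ∷ xs) = +-mono-≤ (f≤g x) (sum-map-mono-≤ f≤g xs)

  length-filter-∷ : ∀ {p} {P : Pred A p} (P? : Decidable P) x xs →
                    length (filter P? (x ∷ xs)) ≡ indicator (P? x) + length (filter P? xs)
  length-filter-∷ P? x xs with does (P? x)
  ... | true  = refl
  ... | false = refl

  length-filter≡sum-indicator : ∀ {p} {P : Pred A p} (P? : Decidable P) xs →
                                length (filter P? xs) ≡ sum (map (λ x → indicator (P? x)) xs)
  length-filter≡sum-indicator P? []       = refl
  length-filter≡sum-indicator P? (x ∷ xs) =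
    trans (length-filter-∷ P? x xs) (cong (indicator (P? x) +_) (length-filter≡sum-indicator P? xs))

  any-≤-of-sum-≤ : (f g : A → ℕ) (xs : List A) → 0 < sum (map g xs) →
                   sum (map f xs) ≤ sum (map g xs) → Any (λ x → f x ≤ g x) xs
  any-≤-of-sum-≤ f g (x ∷ xs) _ Σf≤Σg with f x ≤? g x
  ... | yes fx≤gx = here fx≤gx
  ... | no  fx≰gx = there (any-≤-of-sum-≤ f g xs (≤-<-trans z≤n tail<) (<⇒≤ tail<))
    where
    open ≤-Reasoning
    tail< : sum (map f xs) < sum (map g xs)
    tail< = +-cancelˡ-< (g x) _ _ (begin-strict
      g x + sum (map f xs)  <⟨ +-monoˡ-< _ (≰⇒> fx≰gx) ⟩
      f x + sum (map f xs)  ≤⟨ Σf≤Σg ⟩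
      g x + sum (map g xs)  ∎)

  any-mediant : (e v : A → ℕ) {E V : ℕ} (xs : List A) → 0 < E → 0 < V →
                E ≤ sum (map e xs) → sum (map v xs) ≤ V → Any (λ x → E * v x ≤ e x * V) xs
  any-mediant e v {E} {V} xs 0<E 0<V E≤Σe Σv≤V =
    any-≤-of-sum-≤ _ _ xs (<-≤-trans (*-mono-< 0<E 0<V) EV≤Σ) (≤-trans ΣEv≤EV EV≤Σ)
    where
    open ≤-Reasoning
    ΣEv≤EV : sum (map (λ x → E * v x) xs) ≤ E * V
    ΣEv≤EV = begin
      sum (map (λ x → E * v x) xs)  ≡⟨ sum-map-*ˡ E v xs ⟩
      E * sum (map v xs)            ≤⟨ *-monoʳ-≤ E Σv≤V ⟩
      E * V                         ∎
    EV≤Σ : E * V ≤ sum (map (λ x → e x * V) xs)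
    EV≤Σ = begin
      E * V                         ≤⟨ *-monoˡ-≤ V E≤Σe ⟩
      sum (map e xs) * V            ≡⟨ sum-map-*ʳ V e xs ⟨
      sum (map (λ x → e x * V) xs)  ∎

module _ {a b r} {A : Set a} {B : Set b} {R : A → B → Set r} where

  sum-length-filter-comm : (R? : ∀ x y → Dec (R x y)) (xs : List A) (ys : List B) →
    sum (map (λ x → length (filter (R? x) ys)) xs) ≡
    sum (map (λ y → length (filter (λ x → R? x y) xs)) ys)
  sum-length-filter-comm R? [] ys = sym (trans (sum-map-const 0 ys) (*-zeroʳ (length ys)))
  sum-length-filter-comm R? (x ∷ xs) ys = begin
    length (filter (R? x) ys) + sum (map (λ x → length (filter (R? x) ys)) xs)
      ≡⟨ cong₂ _+_ (length-filter≡sum-indicator (R? x) ys) (sum-length-filter-comm R? xs ys) ⟩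
    sum (map (λ y → indicator (R? x y)) ys) + sum (map (λ y → length (filter (λ x → R? x y) xs)) ys)
      ≡⟨ sum-map-+ _ _ ys ⟨
    sum (map (λ y → indicator (R? x y) + length (filter (λ x → R? x y) xs)) ys)
      ≡⟨ cong sum (map-cong (λ y → length-filter-∷ (λ x → R? x y) x xs) ys) ⟨
    sum (map (λ y → length (filter (λ x → R? x y) (x ∷ xs))) ys)
      ∎
    where open ≡-Reasoning

module _ (G : Graph) (col : Colouring G) where

  edges : List (Fin (m G))
  edges = tabulate (λ e → e)

  vertices : List (Fin (n G))
  vertices = tabulate (λ v → v)

  HasColourAt? : ∀ c v → Dec (Σ (Fin (m G)) λ e → col e ≡ c × Incident G e v)
  HasColourAt? c v = any? (λ e → (col e ≟ c) ×-dec incident? G e v)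

  m≤sum-edgesOfColour : (cs : List ℕ) → (∀ e → col e ∈ cs) →
                        m G ≤ sum (map (edgesOfColour G col) cs)
  m≤sum-edgesOfColour cs col∈cs = begin
    m G                          ≡⟨ length-tabulate (λ e → e) ⟨
    length edges                 ≡⟨ *-identityʳ (length edges) ⟨
    length edges * 1             ≡⟨ sum-map-const 1 edges ⟨
    sum (map (λ _ → 1) edges)    ≤⟨ sum-map-mono-≤ (λ e → ∈-length (∈-filter⁺ (col e ≟_) (col∈cs e) refl)) edges ⟩
    sum (map (λ e → length (filter (col e ≟_) cs)) edges)
                                 ≡⟨ sum-length-filter-comm (λ c e → col e ≟ c) cs edges ⟨
    sum (map (edgesOfColour G col) cs)  ∎
    where open ≤-Reasoning

  sum-verticesOfColour≤ : ∀ {q} → IsEdgeQColouring G q col → (cs : List ℕ) → Unique cs →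
                          sum (map (verticesOfColour G col) cs) ≤ n G * q
  sum-verticesOfColour≤ {q} q-col cs unique = begin
    sum (map (verticesOfColour G col) cs)  ≡⟨ sum-length-filter-comm HasColourAt? cs vertices ⟩
    sum (map (λ v → length (filter (λ c → HasColourAt? c v) cs)) vertices)
                                           ≤⟨ sum-map-mono-≤ coloursAt≤q vertices ⟩
    sum (map (λ _ → q) vertices)           ≡⟨ sum-map-const q vertices ⟩
    length vertices * q                    ≡⟨ cong (_* q) (length-tabulate {n = n G} (λ v → v)) ⟩
    n G * q                                ∎
    where
    open ≤-Reasoning
    coloursAt≤q : ∀ v → length (filter (λ c → HasColourAt? c v) cs) ≤ q
    coloursAt≤q v = q-col v _ (Unique-filter⁺ _ unique)
      (All.map (λ { (e , colour , incident) → e , incident , colour }) (all-filter _ cs))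

  coloursUsed : List ℕ
  coloursUsed = deduplicate _≟_ (map col (allFin (m G)))

  coloursUsed-unique : Unique coloursUsed
  coloursUsed-unique = deduplicate-! _≟_ (map col (allFin (m G)))

  col∈coloursUsed : ∀ e → col e ∈ coloursUsed
  col∈coloursUsed e = ∈-deduplicate⁺ _≟_ (∈-map⁺ col (∈-allFin e))

  ∈coloursUsed⇒used : ∀ {c} → c ∈ coloursUsed → Σ (Fin (m G)) λ e → col e ≡ c
  ∈coloursUsed⇒used c∈ with ∈-map⁻ col (∈-deduplicate⁻ _≟_ (map col (allFin (m G))) c∈)
  ... | e , _ , c≡col-e = e , sym c≡col-e

lemma7 : (q : ℕ) → 1 ≤ q → (G : Graph) → 0 < m G →
    (col : Colouring G) → IsEdgeQColouring G q col →
    Σ ℕ λ c → (Σ (Fin (m G)) λ e → col e ≡ c) ×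
      2 * edgesOfColour G col c * (n G * q) ≥ 2 * m G * verticesOfColour G col c
lemma7 q 0<q G 0<m col q-col with find mediant
  where
  open ≤-Reasoning
  cs : List ℕ
  cs = coloursUsed G col
  0<n : 0 < n G
  0<n = ≤-<-trans z≤n (toℕ<n (proj₁ (edge G (fromℕ< 0<m))))
  2m≤Σ2E : 2 * m G ≤ sum (map (λ c → 2 * edgesOfColour G col c) cs)
  2m≤Σ2E = begin
    2 * m G                                    ≤⟨ *-monoʳ-≤ 2 (m≤sum-edgesOfColour G col cs (col∈coloursUsed G col)) ⟩
    2 * sum (map (edgesOfColour G col) cs)     ≡⟨ sum-map-*ˡ 2 (edgesOfColour G col) cs ⟨
    sum (map (λ c → 2 * edgesOfColour G col c) cs)  ∎
  mediant : Any (λ c → 2 * m G * verticesOfColour G col c ≤ 2 * edgesOfColour G col c * (n G * q)) cs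
  mediant = any-mediant (λ c → 2 * edgesOfColour G col c) (verticesOfColour G col) cs
    (*-monoʳ-< 2 0<m) (*-mono-< 0<n 0<q) 2m≤Σ2E
    (sum-verticesOfColour≤ G col q-col cs (coloursUsed-unique G col))
... | c , c∈cs , good = c , ∈coloursUsed⇒used G col c∈cs , good
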